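{- Let $G_n$, $T$, $\gamma$ be as in the context. Let $C=u_0e_0u_1e_1\cdots u_{p-1}e_{p-1}u_0$ be a directed cycle in $T$ with $p=|C|$ arcs. Then $p$ divides $n+1$. Moreover, for every $j\in\{0,\dots,p-1\}$, $u_j\,\gamma(u_j)=\big(l(e_{j+1})l(e_{j+2})\cdots l(e_{j+p})\big)^{\frac{n+1}{p}}$, indices taken modulo $p$ (i.e. $u_j\gamma(u_j)$ is the $\frac{n+1}{p}$-fold power of the label of $C$ read starting from the successor $u_{j+1}$ of $u_j$).
   Context: Let $A$ be a finite alphabet with a linear order $<$, extended to words by the lexicographic order. Let $\mathcal{F}$ be a set of words over $A$ (forbidden factors). A word $w$ is in the language if the bi-infinite periodic word $\cdots www\cdots$ contains no word of $\mathcal{F}$ as a factor; $W_k$ denotes the set of words of length $k$ in the language. Fix $n\ge1$. Consider the digraph with vertex set $A^n$ having an arc from $as$ to $sb$ ($a,b\in A$, $s\in A^{n-1}$) whenever $asb\in W_{n+1}$; this arc has label $l=b$. The de Bruijn graph $G_n$ is a strongly connected component of this digraph with the maximum number of vertices (unique when the subshift is irreducible). Vertices are identified with their words; for a word $x$, $x^j$ denotes the concatenation of $j$ copies of $x$. Let $m$ be the lexicographically maximal vertex of $G_n$. For each vertex $v$ let $e(v)$ be the arc of $G_n$ with tail $v$ of maximum label, and $\gamma(v)$ its label. $T$ is the spanning subgraph of $G_n$ with arc set $\{e(v): v\neq m\}$. -}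

module Defs where

open import Level using (0ℓ)
open import Data.Nat using (ℕ; zero; suc; _%_; _<_; NonZero)
import Data.Nat
import Data.List
open import Data.Nat.DivMod using (m%n<n)
open import Data.Fin as Fin using (Fin; toℕ; fromℕ<)
open import Data.List using (List; []; _∷_; _++_; concat; replicate; map; upTo)
open import Data.List.Membership.Propositional using (_∈_)
open import Data.List.Relation.Unary.Unique.Propositional using (Unique)
open import Data.Vec as Vec using (Vec; _∷ʳ_; toList)
open import Data.Vec.Relation.Binary.Lex.NonStrict using (Lex-≤)
open import Data.Product using (Σ; ∃; ∃-syntax; _×_; _,_)
open import Relation.Nullary using (¬_)
open import Relation.Binary.PropositionalEquality using (_≡_)
open import Relation.Binary.Construct.Closure.ReflexiveTransitive using (Star)

-- The alphabet A is Fin k with its usual linear order.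
-- Forbidden factors: an arbitrary set (predicate) of words F.

pow : ∀ {k} → List (Fin k) → ℕ → List (Fin k)
pow x j = concat (replicate j x)

-- u is a factor of the bi-infinite periodic word ⋯www⋯
-- (equivalently, u is a factor of some finite power w^j)
PerFactor : ∀ {k} → List (Fin k) → List (Fin k) → Set
PerFactor u w = ∃[ j ] ∃[ x ] ∃[ y ] (x ++ u ++ y ≡ pow w j)

InLang : ∀ {k} → (List (Fin k) → Set) → List (Fin k) → Set
InLang F w = ¬ (∃[ u ] (F u × PerFactor u w))

succV : ∀ {k n} → Vec (Fin k) n → Fin k → Vec (Fin k) n
succV v b = Vec.tail (v ∷ʳ b)

-- Arc of the digraph on A^n: from v = a s to s b whenever a s b ∈ W_{n+1};
-- the arc is determined by its tail v and label b.
Arc : ∀ {k n} → (List (Fin k) → Set) → Vec (Fin k) n → Fin k → Set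
Arc F v b = InLang F (toList (v ∷ʳ b))

Adj : ∀ {k n} → (List (Fin k) → Set) → Vec (Fin k) n → Vec (Fin k) n → Set
Adj F v w = ∃[ b ] (Arc F v b × succV v b ≡ w)

Reach : ∀ {k n} → (List (Fin k) → Set) → Vec (Fin k) n → Vec (Fin k) n → Set
Reach F = Star (Adj F)

IsSCC : ∀ {k} → (List (Fin k) → Set) → (n : ℕ) → List (Vec (Fin k) n) → Set
IsSCC F n S =
  Unique S ×
  (∃[ v ] (v ∈ S)) ×
  (∀ {v w} → v ∈ S → w ∈ S → Reach F v w) ×
  (∀ {v w} → v ∈ S → Reach F v w → Reach F w v → w ∈ S)

IsDeBruijn : ∀ {k} → (List (Fin k) → Set) → (n : ℕ) → List (Vec (Fin k) n) → Set
IsDeBruijn F n S =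
  IsSCC F n S ×
  (∀ S' → IsSCC F n S' → Data.List.length S' Data.Nat.≤ Data.List.length S)

_≤lex_ : ∀ {k n} → Vec (Fin k) n → Vec (Fin k) n → Set
_≤lex_ = Lex-≤ _≡_ Fin._≤_

IsLexMax : ∀ {k n} → List (Vec (Fin k) n) → Vec (Fin k) n → Set
IsLexMax S m = m ∈ S × (∀ {v} → v ∈ S → v ≤lex m)

ArcG : ∀ {k n} → (List (Fin k) → Set) → List (Vec (Fin k) n) →
       Vec (Fin k) n → Fin k → Set
ArcG F S v b = v ∈ S × Arc F v b × succV v b ∈ S

-- γ(v) ≡ b : e(v) exists and has label b (maximum label among arcs of G leaving v)
IsGamma : ∀ {k n} → (List (Fin k) → Set) → List (Vec (Fin k) n) →
          Vec (Fin k) n → Fin k → Set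
IsGamma F S v b = ArcG F S v b × (∀ b' → ArcG F S v b' → b' Fin.≤ b)

shift : ∀ {p} .{{_ : NonZero p}} → Fin p → ℕ → Fin p
shift {p} j i = fromℕ< (m%n<n (toℕ j Data.Nat.+ i) p)

cycleLabel : ∀ {k p} .{{_ : NonZero p}} → (Fin p → Fin k) → Fin p → List (Fin k)
cycleLabel {p = p} g j = map (λ i → g (shift j (suc i))) (upTo p)

-- Unroll the cycle into sequences U x = u_(x mod p), G x = g_(x mod p), so
-- that U (x+1) = succV (U x) (G x).  Then every vertex is a window of the
-- letter sequence: U (a+n) = G a ⋯ G (a+n-1)  (walk-window).  The word
-- w = G i ⋯ G (i+n) of the arc leaving U (i+n) is in the language, and so
-- are all its rotations; the windows of the periodic word ⋯www⋯ form a
-- closed walk (a "necklace") through U (i+n+1), which by maximality of the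
-- strongly connected component S lies in S.  Its arc leaving U (i+n+1) has
-- label G i, so maximality of γ gives G i ≤ G (i+n+1)  (letter-mono).
-- A p-periodic sequence that weakly increases under x ↦ x+n+1 is
-- (n+1)-periodic (monotone-periodic).  Then U is (n+1)-periodic as well,
-- injectivity of u forces p ∣ n+1, and the power formula is a window of G
-- of length n+1 = q·p cut into q copies of its length-p prefix.
-- Neither the lexicographic maximum m nor the hypothesis 1 ≤ n plays a
-- role: the conclusion holds for every cycle following maximal-label arcs.

module Submission where

open import Defs
open import Data.Nat using (ℕ; zero; suc; _+_; _*_; _%_; _≤_; _<_; _/_; z≤n; s≤s; NonZero)
open import Data.Nat.Properties using (+-identityʳ; +-suc; +-assoc; +-comm; *-comm; m≤n+m; ≤-reflexive)
open import Data.Nat.DivMod using (m%n<n; m%n%n≡m%n; [m+n]%n≡m%n; m<n⇒m%n≡m; %-distribˡ-+; %-remove-+ˡ; m/n*n≡m)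
open import Data.Nat.Divisibility using (_∣_; m∣m*n; n∣m⇒m%n≡0; m%n≡0⇒n∣m)
open import Data.Fin as Fin using (Fin; toℕ; fromℕ<)
open import Data.Fin.Properties using (toℕ-fromℕ<; fromℕ<-cong; fromℕ<-toℕ; toℕ<n)
import Data.Fin.Properties as Finₚ
open import Data.Vec as Vec using (Vec; []; _∷_; _∷ʳ_; toList)
open import Data.Vec.Properties using (toList-∷ʳ; toList-injective; cast-is-id; length-toList)
open import Data.List using (List; []; _∷_; _++_; drop; length; applyUpTo)
open import Data.List.Properties using (++-assoc; ++-identityʳ; length-++; drop-drop; drop-all; map-upTo)
open import Data.List.Membership.Propositional using (_∈_)
open import Data.Product using (_×_; _,_; proj₁; proj₂)
open import Function using (_∘_)
open import Function.Definitions using (Injective)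
open import Relation.Binary.PropositionalEquality
open import Relation.Binary.Construct.Closure.ReflexiveTransitive using (ε; _◅_; _◅◅_)

open ≡-Reasoning

-- The language is closed under rotation: a factor of (x y)^j is a factor
-- of (y x)^(j+1), since y (x y)^j x = (y x)^(j+1).

pow-rotate : ∀ {k} (x y : List (Fin k)) j → y ++ pow (x ++ y) j ++ x ≡ pow (y ++ x) (suc j)
pow-rotate x y zero = sym (++-identityʳ (y ++ x))
pow-rotate x y (suc j) = begin
    y ++ ((x ++ y) ++ pow (x ++ y) j) ++ x   ≡⟨ cong (y ++_) (++-assoc (x ++ y) _ x) ⟩
    y ++ (x ++ y) ++ pow (x ++ y) j ++ x     ≡⟨ cong (y ++_) (++-assoc x y _) ⟩
    y ++ x ++ y ++ pow (x ++ y) j ++ x       ≡⟨ sym (++-assoc y x _) ⟩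
    (y ++ x) ++ y ++ pow (x ++ y) j ++ x     ≡⟨ cong ((y ++ x) ++_) (pow-rotate x y j) ⟩
    (y ++ x) ++ pow (y ++ x) (suc j)         ∎

perFactor-rotate : ∀ {k} (w x y : List (Fin k)) → PerFactor w (x ++ y) → PerFactor w (y ++ x)
perFactor-rotate w x y (j , a , b , a++w++b≡pow) = suc j , y ++ a , b ++ x , (begin
    (y ++ a) ++ w ++ b ++ x     ≡⟨ ++-assoc y a _ ⟩
    y ++ a ++ w ++ b ++ x       ≡⟨ cong (λ z → y ++ a ++ z) (sym (++-assoc w b x)) ⟩
    y ++ a ++ (w ++ b) ++ x     ≡⟨ cong (y ++_) (sym (++-assoc a (w ++ b) x)) ⟩
    y ++ (a ++ w ++ b) ++ x     ≡⟨ cong (λ z → y ++ z ++ x) a++w++b≡pow ⟩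
    y ++ pow (x ++ y) j ++ x    ≡⟨ pow-rotate x y j ⟩
    pow (y ++ x) (suc j)        ∎)

inLang-rotate : ∀ {k} (F : List (Fin k) → Set) (x y : List (Fin k)) → InLang F (x ++ y) → InLang F (y ++ x)
inLang-rotate F x y x++y∈L (w , w∈F , w≺yx) = x++y∈L (w , w∈F , perFactor-rotate w y x w≺yx)

Periodic : ∀ {a} {A : Set a} → (ℕ → A) → ℕ → Set a
Periodic f p = ∀ x → f (x + p) ≡ f x

periodic-multiple : ∀ {a} {A : Set a} {f : ℕ → A} {p} → Periodic f p → ∀ q x → f (x + q * p) ≡ f x
periodic-multiple {f = f} per zero x = cong f (+-identityʳ x)
periodic-multiple {f = f} {p} per (suc q) x = begin
    f (x + (p + q * p))  ≡⟨ cong f (sym (+-assoc x p (q * p))) ⟩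
    f (x + p + q * p)    ≡⟨ periodic-multiple per q (x + p) ⟩
    f (x + p)            ≡⟨ per x ⟩
    f x                  ∎

cyclic : ∀ {a} {A : Set a} → (ℕ → A) → (N : ℕ) .{{_ : NonZero N}} → ℕ → A
cyclic f N r = f (r % N)

cyclic-periodic : ∀ {a} {A : Set a} (f : ℕ → A) N .{{_ : NonZero N}} → Periodic (cyclic f N) N
cyclic-periodic f N x = cong f ([m+n]%n≡m%n x N)

cyclic-agrees : ∀ {a} {A : Set a} (f : ℕ → A) N .{{_ : NonZero N}} {r} → r < N → cyclic f N r ≡ f r
cyclic-agrees f N r<N = cong f (m<n⇒m%n≡m r<N)

module Windows {a} {A : Set a} (f : ℕ → A) where

  window : ℕ → (t : ℕ) → Vec A t
  window a zero = []
  window a (suc t) = f a ∷ window (suc a) t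

  window-snoc : ∀ a t → window a t ∷ʳ f (a + t) ≡ window a (suc t)
  window-snoc a zero = cong (_∷ []) (cong f (+-identityʳ a))
  window-snoc a (suc t) = cong (f a ∷_) (begin
      window (suc a) t ∷ʳ f (a + suc t)  ≡⟨ cong (λ z → window (suc a) t ∷ʳ f z) (+-suc a t) ⟩
      window (suc a) t ∷ʳ f (suc a + t)  ≡⟨ window-snoc (suc a) t ⟩
      window (suc a) (suc t)             ∎)

  toList-window-snoc : ∀ a t → toList (window a t) ++ f (a + t) ∷ [] ≡ toList (window a (suc t))
  toList-window-snoc a t = trans (sym (toList-∷ʳ (f (a + t)) (window a t))) (cong toList (window-snoc a t))

  window-++ : ∀ a s t → toList (window a (s + t)) ≡ toList (window a s) ++ toList (window (a + s) t)
  window-++ a zero t = cong (λ b → toList (window b t)) (sym (+-identityʳ a))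
  window-++ a (suc s) t = cong (f a ∷_)
    (trans (window-++ (suc a) s t) (cong (λ b → toList (window (suc a) s) ++ toList (window b t)) (sym (+-suc a s))))

  window-periodic : ∀ {p} → Periodic f p → ∀ a t → window (a + p) t ≡ window a t
  window-periodic per a zero = refl
  window-periodic per a (suc t) = cong₂ _∷_ (per a) (window-periodic per (suc a) t)

  applyUpTo-window : ∀ (φ : ℕ → A) a t → (∀ r → φ r ≡ f (a + r)) → applyUpTo φ t ≡ toList (window a t)
  applyUpTo-window φ a zero _ = refl
  applyUpTo-window φ a (suc t) φ≗f = cong₂ _∷_
    (trans (φ≗f 0) (cong f (+-identityʳ a)))
    (applyUpTo-window (φ ∘ suc) (suc a) t (λ r → trans (φ≗f (suc r)) (cong f (+-suc a r))))

window-cong : ∀ {a} {A : Set a} {f f' : ℕ → A} {b b'} t →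
              (∀ r → r < t → f (b + r) ≡ f' (b' + r)) → Windows.window f b t ≡ Windows.window f' b' t
window-cong zero _ = refl
window-cong {f = f} {f'} {b} {b'} (suc t) agree = cong₂ _∷_
  (trans (cong f (sym (+-identityʳ b))) (trans (agree 0 (s≤s z≤n)) (cong f' (+-identityʳ b'))))
  (window-cong t (λ r r<t → trans (cong f (sym (+-suc b r))) (trans (agree (suc r) (s≤s r<t)) (cong f' (+-suc b' r)))))

open Windows using (window)

window-pow : ∀ {k} (f : ℕ → Fin k) {p} → Periodic f p → ∀ a q → toList (window f a (q * p)) ≡ pow (toList (window f a p)) q
window-pow f per a zero = refl
window-pow f {p} per a (suc q) = begin
    toList (window f a (p + q * p))                        ≡⟨ Windows.window-++ f a p (q * p) ⟩
    toList (window f a p) ++ toList (window f (a + p) (q * p)) ≡⟨ cong (λ v → toList (window f a p) ++ toList v) (Windows.window-periodic f per a (q * p)) ⟩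
    toList (window f a p) ++ toList (window f a (q * p))     ≡⟨ cong (toList (window f a p) ++_) (window-pow f per a q) ⟩
    toList (window f a p) ++ pow (toList (window f a p)) q   ∎

succV-window : ∀ {k} (f : ℕ → Fin k) a t → succV (window f a t) (f (a + t)) ≡ window f (suc a) t
succV-window f a t = cong Vec.tail (Windows.window-snoc f a t)

toList-succV : ∀ {k n} (v : Vec (Fin k) n) b → toList (succV v b) ≡ drop 1 (toList v ++ b ∷ [])
toList-succV [] b = refl
toList-succV (x ∷ xs) b = toList-∷ʳ b xs

drop-++ : ∀ {a} {A : Set a} t (xs ys : List A) → t ≤ length xs → drop t (xs ++ ys) ≡ drop t xs ++ ys
drop-++ zero xs ys _ = refl
drop-++ (suc t) (x ∷ xs) ys (s≤s t≤∣xs∣) = drop-++ t xs ys t≤∣xs∣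

-- After n
-- steps the starting vertex has been shifted out completely, so each vertex
-- U (a+n) is the window of the n labels read before it.

module Walk {k n} (U : ℕ → Vec (Fin k) n) (G : ℕ → Fin k)
            (step : ∀ x → U (suc x) ≡ succV (U x) (G x)) where

  walk-drop : ∀ a t → toList (U (a + t)) ≡ drop t (toList (U a) ++ toList (window G a t))
  walk-drop a zero = trans (cong (toList ∘ U) (+-identityʳ a)) (sym (++-identityʳ _))
  walk-drop a (suc t) = begin
      toList (U (a + suc t))                     ≡⟨ cong (toList ∘ U) (+-suc a t) ⟩
      toList (U (suc (a + t)))                   ≡⟨ cong toList (step (a + t)) ⟩
      toList (succV (U (a + t)) (G (a + t)))     ≡⟨ toList-succV (U (a + t)) (G (a + t)) ⟩
      drop 1 (toList (U (a + t)) ++ G (a + t) ∷ [])  ≡⟨ cong (λ w → drop 1 (w ++ G (a + t) ∷ [])) (walk-drop a t) ⟩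
      drop 1 (drop t W ++ G (a + t) ∷ [])        ≡⟨ cong (drop 1) (sym (drop-++ t W _ t≤∣W∣)) ⟩
      drop 1 (drop t (W ++ G (a + t) ∷ []))      ≡⟨ drop-drop t 1 _ ⟩
      drop (t + 1) (W ++ G (a + t) ∷ [])         ≡⟨ cong₂ drop (+-comm t 1) (++-assoc L _ _) ⟩
      drop (suc t) (L ++ toList (window G a t) ++ G (a + t) ∷ [])
                                                 ≡⟨ cong (λ w → drop (suc t) (L ++ w)) (Windows.toList-window-snoc G a t) ⟩
      drop (suc t) (L ++ toList (window G a (suc t))) ∎
    where
    L = toList (U a)
    W = L ++ toList (window G a t)
    t≤∣W∣ : t ≤ length W
    t≤∣W∣ = subst (t ≤_)
      (sym (trans (length-++ L) (cong₂ _+_ (length-toList (U a)) (length-toList (window G a t)))))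
      (m≤n+m t n)

  walk-window : ∀ a → U (a + n) ≡ window G a n
  walk-window a = trans (sym (cast-is-id refl (U (a + n)))) (toList-injective refl _ _ (begin
      toList (U (a + n))                ≡⟨ walk-drop a n ⟩
      drop n (L ++ toList (window G a n)) ≡⟨ drop-++ n L _ (≤-reflexive (sym ∣L∣≡n)) ⟩
      drop n L ++ toList (window G a n) ≡⟨ cong (_++ toList (window G a n)) (drop-all n L (≤-reflexive ∣L∣≡n)) ⟩
      toList (window G a n)             ∎))
    where
    L = toList (U a)
    ∣L∣≡n : length L ≡ n
    ∣L∣≡n = length-toList (U a)

  walk-arc-word : ∀ a → U (a + n) ∷ʳ G (a + n) ≡ window G a (suc n)
  walk-arc-word a = trans (cong (_∷ʳ G (a + n)) (walk-window a)) (Windows.window-snoc G a n)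

  walk-periodic : ∀ {M} → Periodic G M → ∀ x → U (x + n + M) ≡ U (x + n)
  walk-periodic {M} per x = begin
      U (x + n + M)     ≡⟨ cong U (trans (+-assoc x n M) (trans (cong (x +_) (+-comm n M)) (sym (+-assoc x M n)))) ⟩
      U (x + M + n)     ≡⟨ walk-window (x + M) ⟩
      window G (x + M) n ≡⟨ Windows.window-periodic G per x n ⟩
      window G x n      ≡⟨ sym (walk-window x) ⟩
      U (x + n)         ∎

module Necklace {k} (F : List (Fin k) → Set) (n : ℕ) (h : ℕ → Fin k)
                (per : Periodic h (suc n)) (base : InLang F (toList (window h 0 (suc n)))) where

  rotations : ∀ r → InLang F (toList (window h r (suc n)))
  rotations zero = base
  rotations (suc r) = subst (InLang F) rotated
    (inLang-rotate F (h r ∷ []) (toList (window h (suc r) n)) (rotations r))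
    where
    rotated : toList (window h (suc r) n) ++ h r ∷ [] ≡ toList (window h (suc r) (suc n))
    rotated = trans (cong (λ b → toList (window h (suc r) n) ++ b ∷ []) (trans (sym (per r)) (cong h (+-suc r n))))
                    (Windows.toList-window-snoc h (suc r) n)

  vertex : ℕ → Vec (Fin k) n
  vertex r = window h r n

  vertex-arc : ∀ r → Arc F (vertex r) (h (r + n))
  vertex-arc r = subst (InLang F) (cong toList (sym (Windows.window-snoc h r n))) (rotations r)

  vertex-adj : ∀ r → Adj F (vertex r) (vertex (suc r))
  vertex-adj r = h (r + n) , vertex-arc r , succV-window h r n

  vertex-reach : ∀ r t → Reach F (vertex r) (vertex (t + r))
  vertex-reach r zero = ε
  vertex-reach r (suc t) = vertex-reach r t ◅◅ (vertex-adj (t + r) ◅ ε)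

  vertex-return : ∀ r → Reach F (vertex (suc r)) (vertex r)
  vertex-return r = subst (Reach F (vertex (suc r))) around (vertex-reach (suc r) n)
    where
    around : vertex (n + suc r) ≡ vertex r
    around = trans (cong vertex (trans (+-comm n (suc r)) (sym (+-suc r n))))
                   (Windows.window-periodic h per r n)

-- Along a walk in the component S that always takes the
-- arc of maximal label, the label cannot decrease after n+1 steps: the
-- necklace of the word G i ⋯ G (i+n) provides an arc of G_n leaving
-- U (i+n+1) with label G i.

module MaximalWalk {k} (F : List (Fin k) → Set) (n : ℕ) (S : List (Vec (Fin k) n))
                   (closed : ∀ {v w} → v ∈ S → Reach F v w → Reach F w v → w ∈ S)
                   (U : ℕ → Vec (Fin k) n) (G : ℕ → Fin k)
                   (step : ∀ x → U (suc x) ≡ succV (U x) (G x))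
                   (maximal : ∀ x → IsGamma F S (U x) (G x)) where

  open Walk U G step

  letter-mono : ∀ i → G i Fin.≤ G (i + suc n)
  letter-mono i = proj₂ (maximal (i + suc n)) (G i) (subst₂ (ArcG F S) (sym U≡v₁) label arc₁)
    where
    h : ℕ → Fin k
    h = cyclic (λ r → G (i + r)) (suc n)

    base : InLang F (toList (window h 0 (suc n)))
    base = subst (InLang F) (cong toList (begin
        U (i + n) ∷ʳ G (i + n)  ≡⟨ walk-arc-word i ⟩
        window G i (suc n)      ≡⟨ window-cong (suc n) (λ r r<N → sym (cyclic-agrees (λ r → G (i + r)) (suc n) r<N)) ⟩
        window h 0 (suc n)      ∎))
      (proj₁ (proj₂ (proj₁ (maximal (i + n)))))

    open Necklace F n h (cyclic-periodic (λ r → G (i + r)) (suc n)) base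

    U≡v₁ : U (i + suc n) ≡ vertex 1
    U≡v₁ = begin
        U (i + suc n)    ≡⟨ cong U (+-suc i n) ⟩
        U (suc i + n)    ≡⟨ walk-window (suc i) ⟩
        window G (suc i) n ≡⟨ window-cong n (λ r r<n → trans (cong G (sym (+-suc i r))) (sym (cyclic-agrees (λ r → G (i + r)) (suc n) (s≤s r<n)))) ⟩
        vertex 1         ∎

    label : h (suc n) ≡ G i
    label = trans (cyclic-periodic (λ r → G (i + r)) (suc n) 0)
                  (trans (cyclic-agrees (λ r → G (i + r)) (suc n) (s≤s z≤n)) (cong G (+-identityʳ i)))

    v₁∈S : vertex 1 ∈ S
    v₁∈S = subst (_∈ S) U≡v₁ (proj₁ (proj₁ (maximal (i + suc n))))

    arc₁ : ArcG F S (vertex 1) (h (suc n))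
    arc₁ = v₁∈S , vertex-arc 1 ,
           subst (_∈ S) (sym (succV-window h 1 n)) (closed v₁∈S (vertex-adj 1 ◅ ε) (vertex-return 1))

-- A p-periodic sequence with f x ≤ f (x+N) everywhere is N-periodic:
-- f x ≤ f (x+N) ≤ ⋯ ≤ f (x + p·N) = f x.

monotone-periodic : ∀ {k} (f : ℕ → Fin k) N p → (∀ x → f x Fin.≤ f (x + N)) → Periodic f (suc p) → Periodic f N
monotone-periodic f N p mono per x = Finₚ.≤-antisym back (mono x)
  where
  iterate : ∀ q y → f y Fin.≤ f (y + q * N)
  iterate zero y = Finₚ.≤-reflexive (cong f (sym (+-identityʳ y)))
  iterate (suc q) y = Finₚ.≤-trans (mono y) (subst (λ z → f (y + N) Fin.≤ f z) (+-assoc y N (q * N)) (iterate q (y + N)))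

  back : f (x + N) Fin.≤ f x
  back = subst (f (x + N) Fin.≤_)
    (trans (cong f (trans (+-assoc x N (p * N)) (cong (x +_) (*-comm (suc p) N)))) (periodic-multiple per N x))
    (iterate p (x + N))

module CycleIndex {p : ℕ} .{{_ : NonZero p}} where

  idx : ℕ → Fin p
  idx x = fromℕ< (m%n<n x p)

  toℕ-idx : ∀ x → toℕ (idx x) ≡ x % p
  toℕ-idx x = toℕ-fromℕ< (m%n<n x p)

  idx-mod : ∀ {x y} → x % p ≡ y % p → idx x ≡ idx y
  idx-mod eq = fromℕ<-cong _ _ eq _ _

  idx-periodic : Periodic idx p
  idx-periodic x = idx-mod ([m+n]%n≡m%n x p)

  idx-suc : ∀ x → shift (idx x) 1 ≡ idx (suc x)
  idx-suc x = idx-mod (begin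
      (toℕ (idx x) + 1) % p      ≡⟨ cong (λ z → (z + 1) % p) (toℕ-idx x) ⟩
      (x % p + 1) % p            ≡⟨ %-distribˡ-+ (x % p) 1 p ⟩
      (x % p % p + 1 % p) % p    ≡⟨ cong (λ z → (z + 1 % p) % p) (m%n%n≡m%n x p) ⟩
      (x % p + 1 % p) % p        ≡⟨ sym (%-distribˡ-+ x 1 p) ⟩
      (x + 1) % p                ≡⟨ cong (_% p) (+-comm x 1) ⟩
      suc x % p                  ∎)

  idx-toℕ : ∀ (j : Fin p) → idx (toℕ j) ≡ j
  idx-toℕ j = trans (fromℕ<-cong _ _ (m<n⇒m%n≡m (toℕ<n j)) _ (toℕ<n j)) (fromℕ<-toℕ j (toℕ<n j))

  idx-return : ∀ (j : Fin p) q → idx (toℕ j + q * p) ≡ j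
  idx-return j q = trans (periodic-multiple idx-periodic q (toℕ j))
                         (idx-toℕ j)

  injective-period-divides : ∀ {X : Set} (u : Fin p → X) → Injective _≡_ _≡_ u →
                             ∀ y N → p ∣ y → u (idx (y + N)) ≡ u (idx y) → p ∣ N
  injective-period-divides u inj y N p∣y repeats = m%n≡0⇒n∣m N p (begin
      N % p        ≡⟨ sym (%-remove-+ˡ N p∣y) ⟩
      (y + N) % p  ≡⟨ sym (toℕ-idx (y + N)) ⟩
      toℕ (idx (y + N)) ≡⟨ cong toℕ (inj repeats) ⟩
      toℕ (idx y)  ≡⟨ toℕ-idx y ⟩
      y % p        ≡⟨ n∣m⇒m%n≡0 y p p∣y ⟩
      0            ∎)

corollary1 : ∀ {k : ℕ} (F : List (Fin k) → Set) (n : ℕ) → 1 ≤ n →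
    (S : List (Vec (Fin k) n)) → IsDeBruijn F n S →
    (m : Vec (Fin k) n) → IsLexMax S m →
    (p : ℕ) .{{_ : NonZero p}} →
    (u : Fin p → Vec (Fin k) n) → Injective _≡_ _≡_ u →
    (g : Fin p → Fin k) →
    (∀ j → u j ≢ m × IsGamma F S (u j) (g j) × succV (u j) (g j) ≡ u (shift j 1)) →
    (p ∣ suc n) ×
    (∀ j → toList (u j) ++ (g j ∷ []) ≡ pow (cycleLabel g j) (suc n / p))
corollary1 {k} F n _ S deBruijn _ _ (suc p') u inj g cycle = p∣N , power
  where
  open CycleIndex {suc p'}
  N = suc n
  p = suc p'

  U : ℕ → Vec (Fin k) n
  U = u ∘ idx
  G : ℕ → Fin k
  G = g ∘ idx

  step : ∀ x → U (suc x) ≡ succV (U x) (G x)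
  step x = sym (trans (proj₂ (proj₂ (cycle (idx x)))) (cong u (idx-suc x)))

  open Walk U G step
  open MaximalWalk F n S (proj₂ (proj₂ (proj₂ (proj₁ deBruijn)))) U G step (proj₁ ∘ proj₂ ∘ cycle ∘ idx)

  G-period-N : Periodic G N
  G-period-N = monotone-periodic G N p' letter-mono (cong g ∘ idx-periodic)

  p∣N : p ∣ N
  p∣N = injective-period-divides u inj (p' * n + n) N
    (subst (p ∣_) (+-comm n (p' * n)) (m∣m*n n)) (walk-periodic G-period-N (p' * n))

  power : ∀ j → toList (u j) ++ g j ∷ [] ≡ pow (cycleLabel g j) (N / p)
  power j = begin
      toList (u j) ++ g j ∷ []                     ≡⟨ cong (λ i → toList (u i) ++ g i ∷ []) j≡idx ⟩
      toList (U (suc (toℕ j) + n)) ++ G (suc (toℕ j) + n) ∷ []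
                                                   ≡⟨ sym (toList-∷ʳ _ (U (suc (toℕ j) + n))) ⟩
      toList (U (suc (toℕ j) + n) ∷ʳ G (suc (toℕ j) + n)) ≡⟨ cong toList (walk-arc-word (suc (toℕ j))) ⟩
      toList (window G (suc (toℕ j)) N)            ≡⟨ cong (toList ∘ window G (suc (toℕ j))) (sym q*p≡N) ⟩
      toList (window G (suc (toℕ j)) (q * p))      ≡⟨ window-pow G (cong g ∘ idx-periodic) (suc (toℕ j)) q ⟩
      pow (toList (window G (suc (toℕ j)) p)) q    ≡⟨ cong (λ w → pow w q) (sym label≡window) ⟩
      pow (cycleLabel g j) q                       ∎
    where
    q = N / p
    q*p≡N : q * p ≡ N
    q*p≡N = m/n*n≡m p∣N
    j≡idx : j ≡ idx (suc (toℕ j) + n)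
    j≡idx = trans (sym (idx-return j q)) (cong idx (trans (cong (toℕ j +_) q*p≡N) (+-suc (toℕ j) n)))
    label≡window : cycleLabel g j ≡ toList (window G (suc (toℕ j)) p)
    label≡window = trans (map-upTo _ p) (Windows.applyUpTo-window G _ (suc (toℕ j)) p (λ r → cong G (+-suc (toℕ j) r)))
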